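{- Let $\omega=\frac{ -1+\sqrt{ -3}}{2}$ and let $\frac{r}{s}>1$ be an irreducible fraction. If $r$ is not a multiple of $3$, then $J_{\frac rs}(\omega)\in\{\pm1,\pm\omega,\pm\omega^2\}$; if $r$ is a multiple of $3$, then $J_{\frac rs}(\omega)\in\{\pm(1-\omega),\pm\omega(1-\omega),\pm\omega^2(1-\omega)\}$. In particular, $|V_{\frac rs}(-\omega)|=|J_{\frac rs}(\omega)|$ equals $\sqrt3$ if $3\mid r$ and $1$ otherwise.
   Context: For a rational $\alpha>0$, $L(\alpha)$ denotes the rational (two-bridge) link associated with $\alpha$ via its continued fraction expansion, and $V_\alpha(t)\in\mathbb Z[t^{\pm1/2}]$ its Jones polynomial. The normalized Jones polynomial is $J_\alpha(q)=\pm t^{ -h}V_\alpha(t)|_{t=-q^{ -1}}$, where $\pm t^h$ is the leading term of $V_\alpha(t)$. It is known that for $\alpha>1$, $J_\alpha(q)=q\mathcal{R}_\alpha(q)+(1-q)\mathcal{S}_\alpha(q)$, where: $[c]_q=\frac{1-q^c}{1-q}$; writing $\alpha=c_1-\cfrac{1}{c_2-\cfrac{1}{\ddots-\cfrac{1}{c_l}}}$ with integers $c_j\ge2$ (unique) and $M^-_q(c)=\begin{pmatrix}[c]_q & -q^{c-1}\\ 1 & 0\end{pmatrix}$, one has $\begin{pmatrix}\mathcal{R}_\alpha(q)\\ \mathcal{S}_\alpha(q)\end{pmatrix}=M^-_q(c_1)\cdots M^-_q(c_l)\begin{pmatrix}1\\0\end{pmatrix}$. An irreducible fraction $\frac rs$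 means $\gcd(r,s)=1$, $s>0$. -}

module Defs where

open import Data.Nat as ℕ using (ℕ; zero; suc)
open import Data.Integer as ℤ using (ℤ; +_; -_)
open import Data.List using (List; []; _∷_)
open import Data.Product using (_×_; _,_)
open import Data.Sum using (_⊎_)
open import Relation.Binary.PropositionalEquality using (_≡_)

-- Eisenstein integers ℤ[ω], ω = (-1+√-3)/2, ω² = -1 - ω.
-- An element  re + im·ω.
record ℤω : Set where
  constructor _+_ω
  field
    re : ℤ
    im : ℤ
open ℤω public

infixl 6 _⊕_ _⊖_
infixl 7 _⊗_

_⊕_ : ℤω → ℤω → ℤω
(a + b ω) ⊕ (c + d ω) = (a ℤ.+ c) + (b ℤ.+ d) ω

⊖_ : ℤω → ℤω
⊖ (a + b ω) = (ℤ.- a) + (ℤ.- b) ω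

_⊖_ : ℤω → ℤω → ℤω
x ⊖ y = x ⊕ (⊖ y)

-- (a+bω)(c+dω) = ac + (ad+bc)ω + bd ω² = (ac - bd) + (ad + bc - bd)ω
_⊗_ : ℤω → ℤω → ℤω
(a + b ω) ⊗ (c + d ω) =
  (a ℤ.* c ℤ.- b ℤ.* d) + (a ℤ.* d ℤ.+ b ℤ.* c ℤ.- b ℤ.* d) ω

0ω 1ω ω : ℤω
0ω = (+ 0) + (+ 0) ω
1ω = (+ 1) + (+ 0) ω
ω  = (+ 0) + (+ 1) ω

ω^ : ℕ → ℤω
ω^ zero = 1ω
ω^ (suc n) = ω ⊗ ω^ n

-- q-integer [c]_q = 1 + q + ... + q^{c-1}, evaluated at q = ω
[_]ω : ℕ → ℤω
[ zero ]ω = 0ω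
[ suc c ]ω = [ c ]ω ⊕ ω^ c

-- q^{c-1} at q = ω (only used for c ≥ 2)
ω^pred : ℕ → ℤω
ω^pred c = ω^ (c ℕ.∸ 1)

-- (R_α(ω), S_α(ω)) = M⁻_ω(c₁) ⋯ M⁻_ω(c_l) (1,0)ᵀ,
-- M⁻_q(c) = [[ [c]_q , -q^{c-1} ], [ 1 , 0 ]]
RS : List ℕ → ℤω × ℤω
RS [] = 1ω , 0ω
RS (c ∷ cs) with RS cs
... | R , S = ([ c ]ω ⊗ R ⊖ ω^pred c ⊗ S) , R

-- J_α(ω) = ω R_α(ω) + (1 - ω) S_α(ω), α given by its expansion cs
Jω : List ℕ → ℤω
Jω cs with RS cs
... | R , S = ω ⊗ R ⊕ (1ω ⊖ ω) ⊗ S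

-- Value of the negative continued fraction c₁ - 1/(c₂ - 1/(⋯ - 1/c_l))
-- as a (numerator , denominator) pair: the matrix product
-- [[c,-1],[1,0]] ⋯ applied to (1,0)ᵀ.
cfrac : List ℕ → ℤ × ℤ
cfrac [] = + 1 , + 0
cfrac (c ∷ cs) with cfrac cs
... | p , q = (+ c) ℤ.* p ℤ.- q , p

numer denom : List ℕ → ℤ
numer cs with cfrac cs
... | p , _ = p
denom cs with cfrac cs
... | _ , q = q

InUnitsTimes : ℤω → ℤω → Set
InUnitsTimes u z =
  z ≡ u ⊎ z ≡ ⊖ u ⊎ z ≡ ω ⊗ u ⊎ z ≡ ⊖ (ω ⊗ u)
    ⊎ z ≡ ω^ 2 ⊗ u ⊎ z ≡ ⊖ (ω^ 2 ⊗ u)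

normω : ℤω → ℤ
normω (a + b ω) = a ℤ.* a ℤ.- a ℤ.* b ℤ.+ b ℤ.* b

-- At q = ω the matrices M⁻_q(c) depend only on c mod 3, and for c ≥ 2 they preserve the
-- 24-element set of pairs u·v, with u one of the six units of ℤ[ω] and v one of (1,0), (0,1),
-- (1,1), (1,-ω).  A finite computation checks this, and that on this set J = ωR + (1-ω)S is a
-- unit when 3 ∤ R(1), and a unit times 1-ω with 3 ∤ S(1) when 3 ∣ R(1); here x(1) is the
-- evaluation a + bω ↦ a + b, a ring map modulo 3.  It turns M⁻_ω(c) into the matrix
-- [[c,-1],[1,0]] of the continued fraction, so R(1) ≡ p and S(1) ≡ q (mod 3) for the fraction
-- p/q = r/s.  As gcd(r,s) = 1, 3 ∣ r gives 3 ∣ p, and 3 ∣ p gives 3 ∣ r or 3 ∣ q.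

module Submission where

open import Defs
open import Data.Nat using (ℕ; _≤_; _<_)
open import Data.Nat.Divisibility using (_∣_)
open import Data.Nat.Coprimality using (Coprime)
open import Data.Integer using (ℤ; +_) renaming (_*_ to _*ℤ_)
open import Data.List using (List; _∷_)
open import Data.List.Relation.Unary.All using (All)
open import Data.Product using (_×_)
open import Relation.Binary.PropositionalEquality using (_≡_)
open import Relation.Nullary using (¬_)

open import Data.Nat using (zero; suc; z≤n; s≤s)
import Data.Nat as ℕ
import Data.Nat.Properties as ℕ
open import Data.Nat.Divisibility using (∣m⇒∣m*n)
open import Data.Nat.Primality using (Prime; prime?; euclidsLemma; ¬prime[1])
import Data.Integer as ℤ
import Data.Integer.Properties as ℤ
import Data.Integer.Divisibility.Signed as ℤ
open import Data.Integer.Tactic.RingSolver using (solve-∀)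
open import Data.List using ([]; map; cartesianProductWith)
open import Data.List.Membership.Propositional using (_∈_)
import Data.List.Membership.DecPropositional as DecMembership
open import Data.List.Relation.Unary.All using ([]; _∷_; all?; lookup)
open import Data.List.Relation.Unary.Any using (here; there)
open import Data.Product using (_,_; proj₁; proj₂)
open import Data.Product.Properties using (≡-dec)
open import Data.Sum using (_⊎_; inj₁; inj₂; [_,_]′; map₂)
open import Relation.Binary.Definitions using (DecidableEquality)
open import Relation.Binary.PropositionalEquality using (refl; sym; trans; cong; cong₂; subst)
open import Relation.Nullary using (Dec; contradiction)
open import Relation.Nullary.Decidable using (from-yes; map′; ¬?; _×-dec_; _⊎-dec_; _→-dec_)

infix 4 _≡₃_
record _≡₃_ (a b : ℤ) : Set where
  constructor mod3
  field
    3∣difference : + 3 ℤ.∣ a ℤ.- b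

≡⇒≡₃ : ∀ {a b} → a ≡ b → a ≡₃ b
≡⇒≡₃ {a} refl = mod3 (ℤ.divides (+ 0) (ℤ.+-inverseʳ a))

≡₃-refl : ∀ {a} → a ≡₃ a
≡₃-refl = ≡⇒≡₃ refl

≡₃-sym : ∀ {a b} → a ≡₃ b → b ≡₃ a
≡₃-sym {a} {b} (mod3 3∣a-b) = mod3 (subst (+ 3 ℤ.∣_) (negate a b) (ℤ.∣m⇒∣-m 3∣a-b))
  where
  negate : ∀ a b → ℤ.- (a ℤ.- b) ≡ b ℤ.- a
  negate = solve-∀

≡₃-trans : ∀ {a b c} → a ≡₃ b → b ≡₃ c → a ≡₃ c
≡₃-trans {a} {b} {c} (mod3 3∣a-b) (mod3 3∣b-c) =
  mod3 (subst (+ 3 ℤ.∣_) (telescope a b c) (ℤ.∣m∣n⇒∣m+n 3∣a-b 3∣b-c))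
  where
  telescope : ∀ a b c → (a ℤ.- b) ℤ.+ (b ℤ.- c) ≡ a ℤ.- c
  telescope = solve-∀

+-cong₃ : ∀ {a b c d} → a ≡₃ b → c ≡₃ d → a ℤ.+ c ≡₃ b ℤ.+ d
+-cong₃ {a} {b} {c} {d} (mod3 3∣a-b) (mod3 3∣c-d) =
  mod3 (subst (+ 3 ℤ.∣_) (regroup a b c d) (ℤ.∣m∣n⇒∣m+n 3∣a-b 3∣c-d))
  where
  regroup : ∀ a b c d → (a ℤ.- b) ℤ.+ (c ℤ.- d) ≡ (a ℤ.+ c) ℤ.- (b ℤ.+ d)
  regroup = solve-∀

-‿cong₃ : ∀ {a b c d} → a ≡₃ b → c ≡₃ d → a ℤ.- c ≡₃ b ℤ.- d
-‿cong₃ {a} {b} {c} {d} (mod3 3∣a-b) (mod3 3∣c-d) =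
  mod3 (subst (+ 3 ℤ.∣_) (regroup a b c d) (ℤ.∣m∣n⇒∣m-n 3∣a-b 3∣c-d))
  where
  regroup : ∀ a b c d → (a ℤ.- b) ℤ.- (c ℤ.- d) ≡ (a ℤ.- c) ℤ.- (b ℤ.- d)
  regroup = solve-∀

*-cong₃ : ∀ {a b c d} → a ≡₃ b → c ≡₃ d → a ℤ.* c ≡₃ b ℤ.* d
*-cong₃ {a} {b} {c} {d} (mod3 3∣a-b) (mod3 3∣c-d) =
  mod3 (subst (+ 3 ℤ.∣_) (regroup a b c d)
    (ℤ.∣m∣n⇒∣m+n (ℤ.∣m⇒∣m*n c 3∣a-b) (ℤ.∣n⇒∣m*n b 3∣c-d)))
  where
  regroup : ∀ a b c d → (a ℤ.- b) ℤ.* c ℤ.+ b ℤ.* (c ℤ.- d) ≡ a ℤ.* c ℤ.- b ℤ.* d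
  regroup = solve-∀

∣-resp-≡₃ : ∀ {a b} → a ≡₃ b → + 3 ℤ.∣ b → + 3 ℤ.∣ a
∣-resp-≡₃ {a} {b} (mod3 3∣a-b) 3∣b = subst (+ 3 ℤ.∣_) (cancel a b) (ℤ.∣m∣n⇒∣m+n 3∣a-b 3∣b)
  where
  cancel : ∀ a b → (a ℤ.- b) ℤ.+ b ≡ a
  cancel = solve-∀

eval₁ : ℤω → ℤ
eval₁ (a + b ω) = a ℤ.+ b

eval₁-⊕ : ∀ x y → eval₁ (x ⊕ y) ≡ eval₁ x ℤ.+ eval₁ y
eval₁-⊕ (a + b ω) (c + d ω) = regroup a b c d
  where
  regroup : ∀ a b c d → (a ℤ.+ c) ℤ.+ (b ℤ.+ d) ≡ (a ℤ.+ b) ℤ.+ (c ℤ.+ d)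
  regroup = solve-∀

eval₁-⊖ : ∀ x y → eval₁ (x ⊖ y) ≡ eval₁ x ℤ.- eval₁ y
eval₁-⊖ (a + b ω) (c + d ω) = regroup a b c d
  where
  regroup : ∀ a b c d → (a ℤ.- c) ℤ.+ (b ℤ.- d) ≡ (a ℤ.+ b) ℤ.- (c ℤ.+ d)
  regroup = solve-∀

-- The relation ω² + ω + 1 = 0 evaluates to 3 = 0.
eval₁-⊗ : ∀ x y → eval₁ (x ⊗ y) ≡₃ eval₁ x ℤ.* eval₁ y
eval₁-⊗ (a + b ω) (c + d ω) = mod3 (ℤ.divides (ℤ.- (b ℤ.* d)) (defect a b c d))
  where
  defect : ∀ a b c d →
    (a ℤ.* c ℤ.- b ℤ.* d) ℤ.+ (a ℤ.* d ℤ.+ b ℤ.* c ℤ.- b ℤ.* d) ℤ.- (a ℤ.+ b) ℤ.* (c ℤ.+ d)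
      ≡ ℤ.- (b ℤ.* d) ℤ.* + 3
  defect = solve-∀

eval₁-ω^ : ∀ n → eval₁ (ω^ n) ≡₃ + 1
eval₁-ω^ zero = ≡₃-refl
eval₁-ω^ (suc n) = ≡₃-trans (eval₁-⊗ ω (ω^ n)) (*-cong₃ (≡₃-refl {+ 1}) (eval₁-ω^ n))

eval₁-[]ω : ∀ n → eval₁ [ n ]ω ≡₃ + n
eval₁-[]ω zero = ≡₃-refl
eval₁-[]ω (suc n) =
  ≡₃-trans (≡⇒≡₃ (eval₁-⊕ [ n ]ω (ω^ n)))
    (≡₃-trans (+-cong₃ (eval₁-[]ω n) (eval₁-ω^ n))
      (≡⇒≡₃ (cong +_ (ℕ.+-comm n 1))))

applyMatrix : ℤω × ℤω → ℤω × ℤω → ℤω × ℤω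
applyMatrix (b , w) (R , S) = b ⊗ R ⊖ w ⊗ S , R

matrixEntries : ℕ → ℤω × ℤω
matrixEntries c = [ c ]ω , ω^pred c

RS-∷ : ∀ c cs → RS (c ∷ cs) ≡ applyMatrix (matrixEntries c) (RS cs)
RS-∷ c cs with RS cs
... | _ , _ = refl

eval₁-RS≡₃fraction : ∀ cs →
  eval₁ (proj₁ (RS cs)) ≡₃ numer cs × eval₁ (proj₂ (RS cs)) ≡₃ denom cs
eval₁-RS≡₃fraction [] = ≡₃-refl , ≡₃-refl
eval₁-RS≡₃fraction (c ∷ cs) with RS cs | cfrac cs | eval₁-RS≡₃fraction cs
... | R , S | p , q | R≡p , S≡q = numerator , R≡p
  where
  numerator : eval₁ ([ c ]ω ⊗ R ⊖ ω^pred c ⊗ S) ≡₃ + c ℤ.* p ℤ.- q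
  numerator =
    ≡₃-trans (≡⇒≡₃ (eval₁-⊖ ([ c ]ω ⊗ R) (ω^pred c ⊗ S)))
      (≡₃-trans (-‿cong₃ (eval₁-⊗ [ c ]ω R) (eval₁-⊗ (ω^pred c) S))
        (≡₃-trans (-‿cong₃ (*-cong₃ (eval₁-[]ω c) R≡p) (*-cong₃ (eval₁-ω^ (c ℕ.∸ 1)) S≡q))
          (≡⇒≡₃ (cong (ℤ._-_ (+ c ℤ.* p)) (ℤ.*-identityˡ q)))))

ω^-periodic : ∀ n → ω^ (3 ℕ.+ n) ≡ ω^ n
ω^-periodic zero = refl
ω^-periodic (suc n) = cong (ω ⊗_) (ω^-periodic n)

[]ω-periodic : ∀ n → [ 3 ℕ.+ n ]ω ≡ [ n ]ω
[]ω-periodic zero = refl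
[]ω-periodic (suc n) = cong₂ _⊕_ ([]ω-periodic n) (ω^-periodic n)

matrixEntries-periodic : ∀ n → matrixEntries (3 ℕ.+ suc n) ≡ matrixEntries (suc n)
matrixEntries-periodic n = cong₂ _,_ ([]ω-periodic (suc n)) (ω^-periodic n)

matrixEntryClasses : List (ℤω × ℤω)
matrixEntryClasses = map matrixEntries (2 ∷ 3 ∷ 4 ∷ [])

matrixEntries∈matrixEntryClasses : ∀ c → 2 ≤ c → matrixEntries c ∈ matrixEntryClasses
matrixEntries∈matrixEntryClasses 1 (s≤s ())
matrixEntries∈matrixEntryClasses 2 _ = here refl
matrixEntries∈matrixEntryClasses 3 _ = there (here refl)
matrixEntries∈matrixEntryClasses 4 _ = there (there (here refl))
matrixEntries∈matrixEntryClasses (suc (suc (suc (suc (suc c))))) _ =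
  subst (_∈ matrixEntryClasses) (sym (matrixEntries-periodic (suc c)))
    (matrixEntries∈matrixEntryClasses (suc (suc c)) (s≤s (s≤s z≤n)))

infix 4 _≟ω_
_≟ω_ : DecidableEquality ℤω
(a + b ω) ≟ω (c + d ω) =
  map′ (λ (a≡c , b≡d) → cong₂ _+_ω a≡c b≡d) (λ eq → cong re eq , cong im eq)
    (a ℤ.≟ c ×-dec b ℤ.≟ d)

open DecMembership (≡-dec _≟ω_ _≟ω_) using (_∈?_)

units : List ℤω
units = 1ω ∷ ⊖ 1ω ∷ ω ∷ ⊖ ω ∷ ω^ 2 ∷ ⊖ ω^ 2 ∷ []

-- Representatives of the four points of ℙ¹(𝔽₃), reading ℤ[ω] modulo 1 - ω.
projectiveLine : List (ℤω × ℤω)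
projectiveLine = (1ω , 0ω) ∷ (0ω , 1ω) ∷ (1ω , 1ω) ∷ (1ω , ⊖ ω) ∷ []

orbit : List (ℤω × ℤω)
orbit = cartesianProductWith (λ u (R , S) → u ⊗ R , u ⊗ S) units projectiveLine

applyMatrix-preserves-orbit : ∀ {e x} → e ∈ matrixEntryClasses → x ∈ orbit → applyMatrix e x ∈ orbit
applyMatrix-preserves-orbit e∈ x∈ = lookup (lookup closed e∈) x∈
  where
  closed : All (λ e → All (λ x → applyMatrix e x ∈ orbit) orbit) matrixEntryClasses
  closed = from-yes (all? (λ e → all? (λ x → applyMatrix e x ∈? orbit) orbit) matrixEntryClasses)

RS∈orbit : ∀ cs → All (2 ≤_) cs → RS cs ∈ orbit
RS∈orbit [] [] = here refl
RS∈orbit (c ∷ cs) (2≤c ∷ 2≤cs) =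
  subst (_∈ orbit) (sym (RS-∷ c cs))
    (applyMatrix-preserves-orbit (matrixEntries∈matrixEntryClasses c 2≤c) (RS∈orbit cs 2≤cs))

jones : ℤω × ℤω → ℤω
jones (R , S) = ω ⊗ R ⊕ (1ω ⊖ ω) ⊗ S

Jω≡jones∘RS : ∀ cs → Jω cs ≡ jones (RS cs)
Jω≡jones∘RS cs with RS cs
... | _ , _ = refl

inUnitsTimes? : ∀ u z → Dec (InUnitsTimes u z)
inUnitsTimes? u z =
  z ≟ω u ⊎-dec z ≟ω ⊖ u ⊎-dec z ≟ω ω ⊗ u ⊎-dec z ≟ω ⊖ (ω ⊗ u)
    ⊎-dec z ≟ω ω^ 2 ⊗ u ⊎-dec z ≟ω ⊖ (ω^ 2 ⊗ u)

JonesDichotomy : ℤω × ℤω → Set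
JonesDichotomy x =
  (¬ (+ 3 ℤ.∣ eval₁ (proj₁ x)) → InUnitsTimes 1ω (jones x) × normω (jones x) ≡ + 1)
  × (+ 3 ℤ.∣ eval₁ (proj₁ x) →
       ¬ (+ 3 ℤ.∣ eval₁ (proj₂ x)) × InUnitsTimes (1ω ⊖ ω) (jones x) × normω (jones x) ≡ + 3)

jonesDichotomy? : ∀ x → Dec (JonesDichotomy x)
jonesDichotomy? x =
  (¬? (+ 3 ℤ.∣? eval₁ (proj₁ x)) →-dec inUnitsTimes? 1ω (jones x) ×-dec normω (jones x) ℤ.≟ + 1)
  ×-dec (+ 3 ℤ.∣? eval₁ (proj₁ x) →-dec
          ¬? (+ 3 ℤ.∣? eval₁ (proj₂ x))
            ×-dec inUnitsTimes? (1ω ⊖ ω) (jones x) ×-dec normω (jones x) ℤ.≟ + 3)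

orbit-jonesDichotomy : ∀ {x} → x ∈ orbit → JonesDichotomy x
orbit-jonesDichotomy = lookup (from-yes (all? jonesDichotomy? orbit))

∣p∣s≡r∣q∣ : ∀ (p q : ℤ) r s → p *ℤ + s ≡ + r *ℤ q → ℤ.∣ p ∣ ℕ.* s ≡ r ℕ.* ℤ.∣ q ∣
∣p∣s≡r∣q∣ p q r s ps≡rq =
  trans (sym (ℤ.abs-* p (+ s))) (trans (cong ℤ.∣_∣ ps≡rq) (ℤ.abs-* (+ r) q))

prime∣r⇒prime∣p : ∀ {π r s} {p q : ℤ} → Prime π → Coprime r s →
  p *ℤ + s ≡ + r *ℤ q → π ∣ r → + π ℤ.∣ p
prime∣r⇒prime∣p {π} {r} {s} {p} {q} π-prime coprime ps≡rq π∣r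
  with euclidsLemma ℤ.∣ p ∣ s π-prime
         (subst (π ∣_) (sym (∣p∣s≡r∣q∣ p q r s ps≡rq)) (∣m⇒∣m*n ℤ.∣ q ∣ π∣r))
... | inj₁ π∣p = ℤ.∣ᵤ⇒∣ π∣p
... | inj₂ π∣s = contradiction (subst Prime (coprime (π∣r , π∣s)) π-prime) ¬prime[1]

prime∣p⇒prime∣r⊎prime∣q : ∀ {π r s} {p q : ℤ} → Prime π →
  p *ℤ + s ≡ + r *ℤ q → + π ℤ.∣ p → π ∣ r ⊎ + π ℤ.∣ q
prime∣p⇒prime∣r⊎prime∣q {π} {r} {s} {p} {q} π-prime ps≡rq π∣p =
  map₂ ℤ.∣ᵤ⇒∣ (euclidsLemma r ℤ.∣ q ∣ π-prime
    (subst (π ∣_) (∣p∣s≡r∣q∣ p q r s ps≡rq) (∣m⇒∣m*n s (ℤ.∣⇒∣ᵤ π∣p))))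

prime[3] : Prime 3
prime[3] = from-yes (prime? 3)

jonesDichotomy⇒cases-on-3∣r : ∀ {r s} {p q : ℤ} (x : ℤω × ℤω) → Coprime r s →
  p *ℤ + s ≡ + r *ℤ q → eval₁ (proj₁ x) ≡₃ p × eval₁ (proj₂ x) ≡₃ q → JonesDichotomy x →
  (¬ 3 ∣ r → InUnitsTimes 1ω (jones x) × normω (jones x) ≡ + 1)
  × (3 ∣ r → InUnitsTimes (1ω ⊖ ω) (jones x) × normω (jones x) ≡ + 3)
jonesDichotomy⇒cases-on-3∣r {r} {s} {p} {q} x coprime ps≡rq (R≡p , S≡q) (unit , ramified) =
  (λ 3∤r → unit λ 3∣R →
    [ 3∤r , (λ 3∣q → proj₁ (ramified 3∣R) (∣-resp-≡₃ S≡q 3∣q)) ]′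
      (prime∣p⇒prime∣r⊎prime∣q {p = p} {q} prime[3] ps≡rq (∣-resp-≡₃ (≡₃-sym R≡p) 3∣R)))
  , (λ 3∣r → proj₂ (ramified
      (∣-resp-≡₃ R≡p (prime∣r⇒prime∣p {p = p} {q} prime[3] coprime ps≡rq 3∣r))))

theorem8p1 : (r s : ℕ) → 1 ≤ s → Coprime r s → s < r →
    (c : ℕ) (cs : List ℕ) → All (2 ≤_) (c ∷ cs) →
    numer (c ∷ cs) *ℤ (+ s) ≡ (+ r) *ℤ denom (c ∷ cs) →
    ((¬ (3 ∣ r)) → InUnitsTimes 1ω (Jω (c ∷ cs)) × normω (Jω (c ∷ cs)) ≡ + 1)
    × ((3 ∣ r) → InUnitsTimes (1ω ⊖ ω) (Jω (c ∷ cs)) × normω (Jω (c ∷ cs)) ≡ + 3)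
theorem8p1 r s _ coprime _ c cs 2≤cs ps≡rq rewrite Jω≡jones∘RS (c ∷ cs) =
  jonesDichotomy⇒cases-on-3∣r (RS (c ∷ cs)) coprime ps≡rq (eval₁-RS≡₃fraction (c ∷ cs))
    (orbit-jonesDichotomy (RS∈orbit (c ∷ cs) 2≤cs))
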